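{- The set $\Omega$ of all positive integer solutions $(x,y)$ of the Pell equation $x^{2}-2y^{2}=-9$ is $$\Omega=\{(21B_{n-1}-3B_{n-2},\;15B_{n-1}-3B_{n-2}) : n\geq 1\},$$ where $B_k$ denotes the $k$-th balancing number.
   Context: Balancing numbers $B_k$ are defined by $B_0=0$, $B_1=1$, $B_k=6B_{k-1}-B_{k-2}$, and this recurrence is used to extend them to negative indices (so $B_{ -1}=-1$, $B_{ -2}=-6$). Equivalently $B_k=\frac{\alpha^{2k}-\beta^{2k}}{4\sqrt{2}}$ for all integers $k$, where $\alpha=1+\sqrt2$, $\beta=1-\sqrt2$. -}

module Defs where

open import Data.Nat using (ℕ; zero; suc)
open import Data.Integer using (ℤ; +_; -[1+_]; _-_; _*_; -_)

Bℕ : ℕ → ℤ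
Bℕ zero = + 0
Bℕ (suc zero) = + 1
Bℕ (suc (suc k)) = + 6 * Bℕ (suc k) - Bℕ k

-- Extension to all integers via the same recurrence; it gives B₋ₖ = −Bₖ
-- (consistent with B₋₁ = −1, B₋₂ = −6 and the Binet formula).
B : ℤ → ℤ
B (+ k) = Bℕ k
B -[1+ k ] = - Bℕ (suc k)

-- Multiplication by the unit α² = 3 + 2√2 of norm 1, (x, y) ↦ (3x + 4y, 2x + 3y), maps
-- solutions of x² − 2y² = −9 to solutions. Conversely, for y ≥ 7 the inverse map
-- (x, y) ↦ (3x − 4y, 3y − 2x) yields a positive solution with smaller y, and the only
-- positive solution with y ≤ 6 is (3, 3). So the positive solutions are exactly the orbit of
-- (3, 3). Its n-th point is (21Bₙ₋₁ − 3Bₙ₋₂, 15Bₙ₋₁ − 3Bₙ₋₂): the map sends this pair to the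
-- one for n + 1 precisely because Bₙ₊₁ = 6Bₙ − Bₙ₋₁.
module Submission where

open import Defs
open import Data.Nat as ℕ using (ℕ; zero; suc; _≤_; _<_; _≥_; s≤s; z≤n)
open import Data.List using (_∷_; [])
open import Data.Product using (Σ; ∃-syntax; _×_; _,_; proj₁; proj₂)
open import Function.Bundles using (_⇔_; mk⇔; Equivalence)
open import Relation.Binary.PropositionalEquality
  using (_≡_; _≢_; refl; sym; trans; cong; cong₂; subst₂; module ≡-Reasoning)

module NaturalSolutions where
  open import Data.Nat using (_+_; _*_; _∸_; _≤?_; _<?_)
  open import Data.Nat.Properties
  open import Data.Nat.Induction using (<-rec)
  open import Data.Nat.Tactic.RingSolver using (solve)
  open import Data.Empty using (⊥-elim)
  open import Induction.WellFounded using (WfRec)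
  open import Relation.Nullary.Decidable using (from-yes)

  m*m<n*n⇒m<n : ∀ {m n} → m * m < n * n → m < n
  m*m<n*n⇒m<n m²<n² = ≰⇒> λ n≤m → <⇒≱ m²<n² (*-mono-≤ n≤m n≤m)

  m*m≤n*n⇒m≤n : ∀ {m n} → m * m ≤ n * n → m ≤ n
  m*m≤n*n⇒m≤n m²≤n² = ≮⇒≥ λ n<m → <⇒≱ (*-mono-< n<m n<m) m²≤n²

  m*m≡n*n⇒m≡n : ∀ {m n} → m * m ≡ n * n → m ≡ n
  m*m≡n*n⇒m≡n m²≡n² = ≤-antisym (m*m≤n*n⇒m≤n (≤-reflexive m²≡n²)) (m*m≤n*n⇒m≤n (≤-reflexive (sym m²≡n²)))

  k*k<n<[1+k]*[1+k]⇒m*m≢n : ∀ m k {n} → k * k < n → n < suc k * suc k → m * m ≢ n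
  k*k<n<[1+k]*[1+k]⇒m*m≢n m k k²<n n<[1+k]² refl =
    <⇒≱ (m*m<n*n⇒m<n {k} k²<n) (m<1+n⇒m≤n (m*m<n*n⇒m<n {m} n<[1+k]²))

  IsPellSolution : ℕ → ℕ → Set
  IsPellSolution a b = 9 + a * a ≡ 2 * (b * b)

  isPellSolution-step⇔ : ∀ a b →
    IsPellSolution a b ⇔ IsPellSolution (3 * a + 4 * b) (2 * a + 3 * b)
  isPellSolution-step⇔ a b = mk⇔
    (λ e → +-cancelʳ-≡ (2 * (b * b)) _ _ (begin
      9 + X * X + 2 * (b * b)    ≡⟨ norm-preserved ⟩
      9 + a * a + 2 * (Y * Y)    ≡⟨ cong (_+ 2 * (Y * Y)) e ⟩
      2 * (b * b) + 2 * (Y * Y)  ≡⟨ +-comm (2 * (b * b)) _ ⟩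
      2 * (Y * Y) + 2 * (b * b)  ∎))
    (λ e → +-cancelʳ-≡ (2 * (Y * Y)) _ _ (begin
      9 + a * a + 2 * (Y * Y)    ≡⟨ sym norm-preserved ⟩
      9 + X * X + 2 * (b * b)    ≡⟨ cong (_+ 2 * (b * b)) e ⟩
      2 * (Y * Y) + 2 * (b * b)  ≡⟨ +-comm (2 * (Y * Y)) _ ⟩
      2 * (b * b) + 2 * (Y * Y)  ∎))
    where
    open ≡-Reasoning
    X = 3 * a + 4 * b
    Y = 2 * a + 3 * b
    norm-preserved : 9 + (3 * a + 4 * b) * (3 * a + 4 * b) + 2 * (b * b)
                   ≡ 9 + a * a + 2 * ((2 * a + 3 * b) * (2 * a + 3 * b))
    norm-preserved = solve (a ∷ b ∷ [])

  -- solX m + solY m √2 = (3 + 3√2) α²ᵐ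
  solX solY : ℕ → ℕ
  solX zero    = 3
  solX (suc m) = 3 * solX m + 4 * solY m
  solY zero    = 3
  solY (suc m) = 2 * solX m + 3 * solY m

  solution-isPellSolution : ∀ m → IsPellSolution (solX m) (solY m)
  solution-isPellSolution zero    = refl
  solution-isPellSolution (suc m) =
    Equivalence.to (isPellSolution-step⇔ (solX m) (solY m)) (solution-isPellSolution m)

  solX-pos : ∀ m → 0 < solX m
  solY-pos : ∀ m → 0 < solY m
  solX-pos zero    = s≤s z≤n
  solX-pos (suc m) = <-≤-trans (*-monoʳ-< 3 (solX-pos m)) (m≤m+n _ _)
  solY-pos zero    = s≤s z≤n
  solY-pos (suc m) = <-≤-trans (*-monoʳ-< 2 (solX-pos m)) (m≤m+n _ _)

  InOrbit : ℕ → ℕ → Set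
  InOrbit a b = ∃[ m ] solX m ≡ a × solY m ≡ b

  inOrbit-step : ∀ {a b} → InOrbit a b → InOrbit (3 * a + 4 * b) (2 * a + 3 * b)
  inOrbit-step (m , refl , refl) = suc m , refl , refl

  module _ {a b : ℕ} (e : IsPellSolution a b) where
    open ≤-Reasoning

    pell-4b≤3a : 7 ≤ b → 4 * b ≤ 3 * a
    pell-4b≤3a b≥7 = m*m≤n*n⇒m≤n (+-cancelʳ-≤ 81 _ _ (begin
      4 * b * (4 * b) + 81           ≤⟨ +-monoʳ-≤ (4 * b * (4 * b)) 81≤2b² ⟩
      4 * b * (4 * b) + 2 * (b * b)  ≡⟨ solve (b ∷ []) ⟩
      9 * (2 * (b * b))              ≡⟨ cong (9 *_) e ⟨
      9 * (9 + a * a)                ≡⟨ solve (a ∷ []) ⟩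
      3 * a * (3 * a) + 81           ∎))
      where
      81≤2b² : 81 ≤ 2 * (b * b)
      81≤2b² = ≤-trans (from-yes (81 ≤? 98)) (*-monoʳ-≤ 2 (*-mono-≤ b≥7 b≥7))

    pell-2a≤3b : 2 * a ≤ 3 * b
    pell-2a≤3b = m*m≤n*n⇒m≤n (begin
      2 * a * (2 * a)                ≤⟨ m≤n+m _ 36 ⟩
      36 + 2 * a * (2 * a)           ≡⟨ solve (a ∷ []) ⟩
      4 * (9 + a * a)                ≡⟨ cong (4 *_) e ⟩
      4 * (2 * (b * b))              ≤⟨ m≤m+n _ (b * b) ⟩
      4 * (2 * (b * b)) + b * b      ≡⟨ solve (b ∷ []) ⟩
      3 * b * (3 * b)                ∎)

    pell-b<a : 3 < b → b < a
    pell-b<a b>3 = m*m<n*n⇒m<n (+-cancelˡ-< 9 _ _ (begin-strict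
      9 + b * b                      <⟨ +-monoˡ-< (b * b) (*-mono-< b>3 b>3) ⟩
      b * b + b * b                  ≡⟨ solve (b ∷ []) ⟩
      2 * (b * b)                    ≡⟨ e ⟨
      9 + a * a                      ∎))

  inverse-step : ∀ {a b a′ b′} → 4 * b + a′ ≡ 3 * a → 2 * a + b′ ≡ 3 * b →
    a ≡ 3 * a′ + 4 * b′ × b ≡ 2 * a′ + 3 * b′
  inverse-step {a} {b} {a′} {b′} eA eB =
    sym (+-cancelʳ-≡ (8 * a) _ _ (begin
      3 * a′ + 4 * b′ + 8 * a      ≡⟨ solve (a ∷ a′ ∷ b′ ∷ []) ⟩
      3 * a′ + 4 * (2 * a + b′)    ≡⟨ cong (λ t → 3 * a′ + 4 * t) eB ⟩
      3 * a′ + 4 * (3 * b)         ≡⟨ solve (a′ ∷ b ∷ []) ⟩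
      3 * (4 * b + a′)             ≡⟨ cong (3 *_) eA ⟩
      3 * (3 * a)                  ≡⟨ solve (a ∷ []) ⟩
      a + 8 * a                    ∎)) ,
    sym (+-cancelʳ-≡ (8 * b) _ _ (begin
      2 * a′ + 3 * b′ + 8 * b      ≡⟨ solve (b ∷ a′ ∷ b′ ∷ []) ⟩
      2 * (4 * b + a′) + 3 * b′    ≡⟨ cong (λ t → 2 * t + 3 * b′) eA ⟩
      2 * (3 * a) + 3 * b′         ≡⟨ solve (a ∷ b′ ∷ []) ⟩
      3 * (2 * a + b′)             ≡⟨ cong (3 *_) eB ⟩
      3 * (3 * b)                  ≡⟨ solve (b ∷ []) ⟩
      b + 8 * b                    ∎))
    where open ≡-Reasoning

  descend : ∀ {a b} → 7 ≤ b → IsPellSolution a b →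
    ∃[ a′ ] ∃[ b′ ] IsPellSolution a′ b′ × b′ < b ×
      a ≡ 3 * a′ + 4 * b′ × b ≡ 2 * a′ + 3 * b′
  descend {a} {b} b≥7 e = a′ , b′ , e′ , b′<b , inverse
    where
    a′ = 3 * a ∸ 4 * b
    b′ = 3 * b ∸ 2 * a
    2a+b′≡3b : 2 * a + b′ ≡ 3 * b
    2a+b′≡3b = m+[n∸m]≡n (pell-2a≤3b {a} {b} e)
    inverse : a ≡ 3 * a′ + 4 * b′ × b ≡ 2 * a′ + 3 * b′
    inverse = inverse-step (m+[n∸m]≡n (pell-4b≤3a {a} {b} e b≥7)) 2a+b′≡3b
    e′ : IsPellSolution a′ b′
    e′ = Equivalence.from (isPellSolution-step⇔ a′ b′)
           (subst₂ IsPellSolution (proj₁ inverse) (proj₂ inverse) e)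
    b<a : b < a
    b<a = pell-b<a {a} {b} e (≤-trans (from-yes (4 ≤? 7)) b≥7)
    b′<b : b′ < b
    b′<b = +-cancelʳ-< (2 * b) b′ b (begin-strict
      b′ + 2 * b                   <⟨ +-monoʳ-< b′ (*-monoʳ-< 2 b<a) ⟩
      b′ + 2 * a                   ≡⟨ +-comm b′ _ ⟩
      2 * a + b′                   ≡⟨ 2a+b′≡3b ⟩
      3 * b                        ≡⟨ solve (b ∷ []) ⟩
      b + 2 * b                    ∎)
      where open ≤-Reasoning

  descent : ∀ b {a} → IsPellSolution a b → InOrbit a b
  descent = <-rec SolutionsInOrbit go
    where
    SolutionsInOrbit : ℕ → Set
    SolutionsInOrbit b = ∀ {a} → IsPellSolution a b → InOrbit a b
    go : ∀ b → WfRec _<_ SolutionsInOrbit b → SolutionsInOrbit b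
    go 0 _ ()
    go 1 _ ()
    go 2 _ ()
    go 3 _ {a} e = 0 , m*m≡n*n⇒m≡n {3} {a} (sym (+-cancelˡ-≡ 9 _ _ e)) , refl
    go 4 _ {a} e = ⊥-elim (k*k<n<[1+k]*[1+k]⇒m*m≢n a 4
                     (from-yes (16 <? 23)) (from-yes (23 <? 25)) (+-cancelˡ-≡ 9 _ _ e))
    go 5 _ {a} e = ⊥-elim (k*k<n<[1+k]*[1+k]⇒m*m≢n a 6
                     (from-yes (36 <? 41)) (from-yes (41 <? 49)) (+-cancelˡ-≡ 9 _ _ e))
    go 6 _ {a} e = ⊥-elim (k*k<n<[1+k]*[1+k]⇒m*m≢n a 7
                     (from-yes (49 <? 63)) (from-yes (63 <? 64)) (+-cancelˡ-≡ 9 _ _ e))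
    go b@(suc (suc (suc (suc (suc (suc (suc c))))))) rec {a} e
      = let a′ , b′ , e′ , b′<b , a≡ , b≡ = descend {a} {b} (m≤m+n 7 c) e
        in subst₂ InOrbit (sym a≡) (sym b≡) (inOrbit-step (rec b′<b {a′} e′))

open NaturalSolutions
  using (IsPellSolution; solX; solY; solution-isPellSolution; solX-pos; solY-pos; descent)

open import Data.Integer using (ℤ; +_; -[1+_]; _+_; _-_; _*_; -_; _>_; +<+)
open import Data.Integer.Properties using (pos-*; +-injective)
open import Function.Properties.Equivalence using () renaming (trans to ⇔-trans)
import Data.Integer.Tactic.RingSolver as ℤ-Solver

i-j≡-k⇔k+i≡j : ∀ i j k → (i - j ≡ - k) ⇔ (k + i ≡ j)
i-j≡-k⇔k+i≡j i j k = mk⇔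
  (λ e → begin
    k + i              ≡⟨ solve (i ∷ j ∷ k ∷ []) ⟩
    k + (i - j) + j    ≡⟨ cong (λ t → k + t + j) e ⟩
    k + - k + j        ≡⟨ solve (j ∷ k ∷ []) ⟩
    j                  ∎)
  (λ e → begin
    i - j              ≡⟨ cong (_-_ i) e ⟨
    i - (k + i)        ≡⟨ solve (i ∷ k ∷ []) ⟩
    - k                ∎)
  where
  open ℤ-Solver using (solve)
  open ≡-Reasoning

pell-ℤ⇔ℕ : ∀ a b → (+ a * + a - + 2 * (+ b * + b) ≡ - + 9) ⇔ IsPellSolution a b
pell-ℤ⇔ℕ a b rewrite sym (pos-* a a) | sym (pos-* b b) | sym (pos-* 2 (b ℕ.* b)) =
  ⇔-trans (i-j≡-k⇔k+i≡j (+ (a ℕ.* a)) (+ (2 ℕ.* (b ℕ.* b))) (+ 9)) (mk⇔ +-injective (cong (+_)))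

B-recurrence : ∀ n → B (+ n) ≡ + 6 * B (+ n - + 1) - B (+ n - + 2)
B-recurrence 0             = refl
B-recurrence 1             = refl
B-recurrence (suc (suc n)) = refl

balancing-step : ∀ b b₋ {u v} →
  u ≡ + 21 * b - + 3 * b₋ → v ≡ + 15 * b - + 3 * b₋ →
  + 3 * u + + 4 * v ≡ + 21 * (+ 6 * b - b₋) - + 3 * b ×
  + 2 * u + + 3 * v ≡ + 15 * (+ 6 * b - b₋) - + 3 * b
balancing-step b b₋ refl refl = solve (b ∷ b₋ ∷ []) , solve (b ∷ b₋ ∷ [])
  where open ℤ-Solver using (solve)

solution-balancing : ∀ m →
  + solX m ≡ + 21 * B (+ suc m - + 1) - + 3 * B (+ suc m - + 2) ×
  + solY m ≡ + 15 * B (+ suc m - + 1) - + 3 * B (+ suc m - + 2)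
solution-balancing zero    = refl , refl
solution-balancing (suc m) rewrite B-recurrence (suc m) =
  let x≡ , y≡ = solution-balancing m
      x-step , y-step = balancing-step (B (+ m)) (B (+ suc m - + 2)) x≡ y≡
  in trans (cong₂ _+_ (pos-* 3 (solX m)) (pos-* 4 (solY m))) x-step ,
     trans (cong₂ _+_ (pos-* 2 (solX m)) (pos-* 3 (solY m))) y-step

IsPositiveSolution : ℤ → ℤ → Set
IsPositiveSolution x y = (x > + 0 × y > + 0) × (x * x - + 2 * (y * y) ≡ - + 9)

HasBalancingForm : ℤ → ℤ → Set
HasBalancingForm x y = Σ ℕ λ n → n ≥ 1 ×
  (x ≡ + 21 * B (+ n - + 1) - + 3 * B (+ n - + 2) ×
   y ≡ + 15 * B (+ n - + 1) - + 3 * B (+ n - + 2))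

solution-isPositiveSolution : ∀ m → IsPositiveSolution (+ solX m) (+ solY m)
solution-isPositiveSolution m =
  (+<+ (solX-pos m) , +<+ (solY-pos m)) ,
  Equivalence.from (pell-ℤ⇔ℕ (solX m) (solY m)) (solution-isPellSolution m)

isPositiveSolution⇒hasBalancingForm : ∀ x y → IsPositiveSolution x y → HasBalancingForm x y
isPositiveSolution⇒hasBalancingForm (+ a) (+ b) (_ , e)
  with m , refl , refl ← descent b {a} (Equivalence.to (pell-ℤ⇔ℕ a b) e)
  = suc m , s≤s z≤n , solution-balancing m
isPositiveSolution⇒hasBalancingForm (+ _)    -[1+ _ ] ((_ , ()) , _)
isPositiveSolution⇒hasBalancingForm -[1+ _ ] _        ((() , _) , _)

hasBalancingForm⇒isPositiveSolution : ∀ {x y} → HasBalancingForm x y → IsPositiveSolution x y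
hasBalancingForm⇒isPositiveSolution (suc m , _ , refl , refl)
  with x≡ , y≡ ← solution-balancing m
  = subst₂ IsPositiveSolution x≡ y≡ (solution-isPositiveSolution m)

theorem2p1 : (x y : ℤ) →
    ((x > + 0 × y > + 0) × (x * x - + 2 * (y * y) ≡ - + 9))
      ⇔ Σ ℕ (λ n → (n ≥ 1) ×
          ((x ≡ + 21 * B (+ n - + 1) - + 3 * B (+ n - + 2)) ×
           (y ≡ + 15 * B (+ n - + 1) - + 3 * B (+ n - + 2))))
theorem2p1 x y =
  mk⇔ (isPositiveSolution⇒hasBalancingForm x y) hasBalancingForm⇒isPositiveSolution
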